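{- Let $C\ge 2$ be even, $D\ge 1$, and let $\mathcal{S}=(S_i)_{i=1}^{2^{D-1}}$ be a partition of $C\cdot 2^{D-1}$ distinct labels into sets of size $C$. Then every schedule for the simultaneous multicast instance $M_{\mathcal{S}}$ has length at least $\frac{CD}{2}$.
   Context: Store-and-forward model: synchronous rounds; each round a node may send packets it holds (copies allowed) to neighbors, at most one packet crossing each edge per round; packet $m_\chi$ of tree $T_\chi$ starts only at the root of $T_\chi$ and may only cross edges of $T_\chi$; a schedule's length is the number of rounds until every leaf of every tree has its tree's packet. Interleaving: for two sets $S_1,S_2$ of $C$ labels each, $I(S_1,S_2)=\{S_1'\cup S_2' : S_j'\subseteq S_j, |S_j'|=C/2\}$; for a tuple $\mathcal{S}=(S_i)_{i=1}^{2^{D-1}}$ of pairwise disjoint $C$-element label sets ($D\ge 2$), $I(\mathcal{S})=\prod_{i=1}^{2^{D-2}} I(S_{2i-1},S_{2i})$. Construction of the labeled graph $G_{\mathcal{S}}$ by recursion on $D$: If $D=1$, $G_{\mathcal{S}}$ is a single edge $(r,v)$ carrying all labels of $S_1$, with $r$ the root of every label. If $D>1$: (1) for each $i=1,\dots,2^{D-2}$ introduce new vertices $r_{2i-1},r_{2i},v_i$ and edges $e_{2i-1}=(r_{2i-1},v_i)$, $e_{2i}=(r_{2i},v_i)$; $e_j$ carries all labels of $S_j$ and $r_j$ is the root of every label of $S_j$; (2) add the disjoint union of $G_{\mathcal{S}'}$ for all $\mathcal{S}'\in I(\mathcal{S})$, edges keeping their labels; (3) in each copy, every root vertex $r$ is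 incident to a single edge with label set $\chi(r)$; if $\chi(r)\in I(S_{2i-1},S_{2i})$, identify $r$ with $v_i$. $M_{\mathcal{S}}$ is the simultaneous multicast instance on $G_{\mathcal{S}}$ with one tree $T_\chi$ per label $\chi$, consisting of the edges carrying $\chi$, rooted at the root of $\chi$, whose leaves are the leaves of this tree. -}

module Defs where

open import Data.Nat using (ℕ; zero; suc; _+_; _*_; _<_; _≤_; ⌊_/2⌋)
open import Data.List using (List; []; _∷_; [_]; _++_; map; concat; concatMap; zipWith; upTo; length; lookup)
open import Data.Fin using (Fin)
open import Data.Bool using (Bool; true; false)
open import Data.Maybe using (Maybe; just)
open import Data.Product using (_×_; _,_; Σ; ∃)
open import Data.Empty using (⊥)
open import Data.List.Membership.Propositional using (_∈_)
open import Relation.Binary.PropositionalEquality using (_≡_)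
open import Relation.Nullary using (¬_)

Label : Set
Label = ℕ

-- Vertices of G_S.
-- `top j`  : the root vertex r_j (0-indexed) of the outermost level.
-- `inner a`: a non-root vertex, addressed by
--    `here i`       : the vertex v_i (0-indexed) of the current level
--                     (for D = 1: `here 0` is the vertex v)
--    `inside k a`   : the vertex with address a inside the k-th copy
--                     G_{S'} (S' the k-th element of the enumeration of I(S)).
-- The root vertices of a copy are identified with the v_i (step (3)).

data Addr : Set where
  here   : ℕ → Addr
  inside : ℕ → Addr → Addr

data Vertex : Set where
  top   : ℕ → Vertex
  inner : Addr → Vertex

record Edge : Set where
  constructor edge
  field
    end₁   : Vertex
    end₂   : Vertex
    labels : List Label
open Edge public

subsets : ℕ → List Label → List (List Label)
subsets zero    xs       = [ [] ]
subsets (suc k) []       = []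
subsets (suc k) (x ∷ xs) = map (x ∷_) (subsets k xs) ++ subsets (suc k) xs

-- I(S) for a tuple S = (S_1, ..., S_{2m}) with half-size h = C/2:
-- the list of all tuples (S'_1,...,S'_m) with S'_i ∈ I(S_{2i-1},S_{2i}).
interleave : ℕ → List (List Label) → List (List (List Label))
interleave h []           = [ [] ]
interleave h (a ∷ [])     = []
interleave h (a ∷ b ∷ r)  =
  concatMap (λ x → concatMap (λ y → map ((x ++ y) ∷_) (interleave h r))
                             (subsets h b))
            (subsets h a)

topEdges : ℕ → List (List Label) → List Edge
topEdges j []       = []
topEdges j (s ∷ ss) = edge (top j) (inner (here ⌊ j /2⌋)) s ∷ topEdges (suc j) ss

liftV : ℕ → Vertex → Vertex
liftV k (top i)   = inner (here i)
liftV k (inner a) = inner (inside k a)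

liftE : ℕ → Edge → Edge
liftE k (edge a b l) = edge (liftV k a) (liftV k b) l

-- graphEdges h d S : edges of G_S for depth D = d + 1, with C/2 = h.
graphEdges : ℕ → ℕ → List (List Label) → List Edge
graphEdges h zero    S = topEdges 0 S
graphEdges h (suc d) S =
  topEdges 0 S ++
  concat (zipWith (λ k S' → map (liftE k) (graphEdges h d S'))
                  (upTo (length (interleave h S))) (interleave h S))

InAt : List (List Label) → ℕ → Label → Set
InAt []       j       χ = ⊥
InAt (s ∷ ss) zero    χ = χ ∈ s
InAt (s ∷ ss) (suc j) χ = InAt ss j χ

IsRoot : List (List Label) → Label → Vertex → Set
IsRoot S χ v = Σ ℕ (λ j → InAt S j χ × v ≡ top j)

Incident : Vertex → Edge → Set
Incident v e = (v ≡ end₁ e) Data.Sum.⊎ (v ≡ end₂ e)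
  where import Data.Sum

-- v is a leaf of T_χ (the tree of edges carrying χ, rooted at the root of χ):
-- v is not the root and exactly one edge of T_χ is incident to v.
IsLeaf : List (List Label) → (E : List Edge) → Label → Vertex → Set
IsLeaf S E χ v =
  ¬ IsRoot S χ v ×
  Σ (Fin (length E)) (λ k →
     (χ ∈ labels (lookup E k) × Incident v (lookup E k)) ×
     (∀ k' → χ ∈ labels (lookup E k') → Incident v (lookup E k') → k' ≡ k))

-- A schedule assigns to each round t and each edge at most one packet,
-- together with a direction (true: end₁ → end₂, false: end₂ → end₁).
Schedule : List Edge → Set
Schedule E = ℕ → Fin (length E) → Maybe (Bool × Label)

sender : Edge → Bool → Vertex
sender e true  = end₁ e
sender e false = end₂ e

receiver : Edge → Bool → Vertex
receiver e true  = end₂ e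
receiver e false = end₁ e

data Holds (S : List (List Label)) (E : List Edge) (σ : Schedule E)
     : ℕ → Vertex → Label → Set where
  init : ∀ {v χ} → IsRoot S χ v → Holds S E σ zero v χ
  keep : ∀ {t v χ} → Holds S E σ t v χ → Holds S E σ (suc t) v χ
  recv : ∀ {t χ} (k : Fin (length E)) (dir : Bool) →
         σ t k ≡ just (dir , χ) →
         Holds S E σ t (sender (lookup E k) dir) χ →
         Holds S E σ (suc t) (receiver (lookup E k) dir) χ

ValidSchedule : (S : List (List Label)) (E : List Edge) → Schedule E → ℕ → Set
ValidSchedule S E σ L =
  ∀ t k dir χ → t < L → σ t k ≡ just (dir , χ) →
  χ ∈ labels (lookup E k) × Holds S E σ t (sender (lookup E k) dir) χ

Completes : (S : List (List Label)) (E : List Edge) → Schedule E → ℕ → Set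
Completes S E σ L = ∀ χ v → IsLeaf S E χ v → Holds S E σ L v χ

module Submission where

-- Write C = 2h.  The idea is an adversary argument by induction on the depth.
-- Call a copy G_{S'} of depth d + 1 inside G_S "late for t₀" if none of its
-- roots holds a label of its own label sets before round t₀.  If such a copy
-- has depth ≥ 2, then during the h rounds [t₀ , t₀ + h) each top edge e_j
-- carries at most h packets; choosing h labels of each S_j that do not cross
-- e_j in that window and interleaving them gives a child copy that is late
-- for t₀ + h, because packets enter the child only through the hubs v_i and
-- reach v_i only over the e_j.  A late copy of depth 1 is a single edge whose
-- 2h packets all have to cross it after t₀ and before L.  Starting from the
-- whole graph (late for 0) we get h·D ≤ L, i.e. C·D ≤ 2L.

open import Defs
open import Data.Bool using (Bool; true; false)
import Data.Bool.Properties as Bool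
open import Data.Empty using (⊥; ⊥-elim)
open import Data.Fin using (Fin; zero; suc; toℕ; fromℕ<)
open import Data.Fin.Properties using (injective⇒≤; toℕ-fromℕ<; any?)
open import Data.List using (List; []; _∷_; [_]; _++_; map; concat; concatMap; zipWith; applyUpTo; length; lookup)
open import Data.List.Membership.Propositional using (_∈_; find; lose)
open import Data.List.Membership.Propositional.Properties
  using (∈-++⁻; ∈-++⁺ˡ; ∈-++⁺ʳ; ∈-map⁻; ∈-map⁺; ∈-lookup; ∈-concatMap⁻; ∈-concatMap⁺)
open import Data.List.Properties using (++-assoc; ++-identityʳ; length-++; map-++; map-∘; map-id)
open import Data.List.Relation.Binary.Sublist.Propositional using (_⊆_; []; _∷_; _∷ʳ_; minimum; ⊆-refl)
open import Data.List.Relation.Binary.Sublist.Propositional.Properties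
  using (All-resp-⊆; Any-resp-⊆; ++⁺; ++⁺ˡ; ++⁺ʳ)
open import Data.List.Relation.Unary.All as All using (All; []; _∷_)
open import Data.List.Relation.Unary.AllPairs using ([]; _∷_)
open import Data.List.Relation.Unary.Any using (here; there; index)
open import Data.List.Relation.Unary.Unique.Propositional using (Unique)
open import Data.Maybe using (Maybe; just; nothing)
open import Data.Maybe.Properties using () renaming (≡-dec to ≡-dec-Maybe)
open import Data.Nat using (ℕ; zero; suc; _+_; _*_; _^_; _∸_; _≤_; _<_; ⌊_/2⌋; z≤n; s≤s; _≟_; _<?_; _≤?_)
open import Data.Nat.Divisibility using (_∣_; divides)
open import Data.Nat.Properties
open import Data.Product using (Σ; _×_; _,_; proj₁; proj₂)
open import Data.Product.Properties using () renaming (≡-dec to ≡-dec-×)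
open import Data.Sum using (_⊎_; inj₁; inj₂; map₂)
import Data.Sum as Sum
open import Relation.Binary.PropositionalEquality
  using (_≡_; _≢_; refl; sym; trans; cong; cong₂; subst; module ≡-Reasoning)
open import Relation.Nullary using (¬_; Dec; yes; no)

window-end : ∀ {n t₀ L} → 1 ≤ n → n ≤ L ∸ t₀ → t₀ + n ≤ L
window-end {n} {t₀} {L} 1≤n n≤ with t₀ ≤? L
... | yes t₀≤L = ≤-trans (+-monoʳ-≤ t₀ n≤) (≤-reflexive (m+[n∸m]≡n t₀≤L))
... | no  t₀≰L = ⊥-elim (<⇒≱ 1≤n (subst (n ≤_) (m≤n⇒m∸n≡0 (<⇒≤ (≰⇒> t₀≰L))) n≤))

double-injective : ∀ m n → m + m ≡ n + n → m ≡ n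
double-injective zero    zero    _  = refl
double-injective (suc m) (suc n) eq =
  cong suc (double-injective m n (suc-injective (trans (sym (+-suc m m)) (trans (suc-injective eq) (+-suc n n)))))

half-double : ∀ q → ⌊ q + q /2⌋ ≡ q
half-double zero    = refl
half-double (suc q) = trans (cong ⌊_/2⌋ (cong suc (+-suc q q))) (cong suc (half-double q))

even⇒double-half : ∀ C → 2 ∣ C → C ≡ ⌊ C /2⌋ + ⌊ C /2⌋
even⇒double-half C (divides q C≡) = trans C≡ (trans q*2≡ (sym (cong₂ _+_ half≡ half≡)))
  where
    q*2≡ : q * 2 ≡ q + q
    q*2≡ = trans (*-comm q 2) (cong (q +_) (+-identityʳ q))
    half≡ : ⌊ C /2⌋ ≡ q
    half≡ = trans (cong ⌊_/2⌋ (trans C≡ q*2≡)) (half-double q)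

positive-half : ∀ n → 2 ≤ n + n → 1 ≤ n
positive-half (suc n) _ = s≤s z≤n

Unique-⊆ : {A : Set} {xs ys : List A} → xs ⊆ ys → Unique ys → Unique xs
Unique-⊆ []         u       = []
Unique-⊆ (_ ∷ʳ τ)   (_ ∷ u) = Unique-⊆ τ u
Unique-⊆ (refl ∷ τ) (p ∷ u) = All-resp-⊆ τ p ∷ Unique-⊆ τ u

Unique-++-disjoint : {A : Set} (xs : List A) {ys : List A} {x : A} →
  Unique (xs ++ ys) → x ∈ xs → x ∈ ys → ⊥
Unique-++-disjoint (_ ∷ xs) (p ∷ _) (here refl) x∈ys = All.lookup p (∈-++⁺ʳ xs x∈ys) refl
Unique-++-disjoint (_ ∷ xs) (_ ∷ u) (there x∈xs) x∈ys = Unique-++-disjoint xs u x∈xs x∈ys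

lookup-injective : {A : Set} {xs : List A} → Unique xs →
  ∀ i j → lookup xs i ≡ lookup xs j → i ≡ j
lookup-injective (p ∷ u) zero    zero    _  = refl
lookup-injective (p ∷ u) zero    (suc j) eq = ⊥-elim (All.lookup p (∈-lookup j) eq)
lookup-injective (p ∷ u) (suc i) zero    eq = ⊥-elim (All.lookup p (∈-lookup i) (sym eq))
lookup-injective (p ∷ u) (suc i) (suc j) eq = cong suc (lookup-injective u i j eq)

-- Counting by pigeonhole: if every element of a duplicate-free list V is
-- related to some slot in Fin n, and each slot is related to at most one
-- element, then V has at most n elements.  (Slots will be rounds of a
-- schedule: an edge carries at most one packet per round.)
slot-bound : {A : Set} {n : ℕ} (R : A → Fin n → Set) →
  (∀ {x y u} → R x u → R y u → x ≡ y) →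
  {V : List A} → Unique V → All (λ x → Σ (Fin n) (R x)) V → length V ≤ n
slot-bound {n = n} R functional {V} uV slots = injective⇒≤ slot-injective
  where
    slot : Fin (length V) → Fin n
    slot i = proj₁ (All.lookup slots (∈-lookup i))

    slot-injective : ∀ {i j} → slot i ≡ slot j → i ≡ j
    slot-injective {i} {j} eq = lookup-injective uV i j
      (functional (proj₂ (All.lookup slots (∈-lookup i)))
                  (subst (R _) (sym eq) (proj₂ (All.lookup slots (∈-lookup j)))))

data ExactlyOne {A : Set} (P : A → Set) : List A → Set where
  this  : ∀ {x xs} → P x → (∀ {y} → y ∈ xs → ¬ P y) → ExactlyOne P (x ∷ xs)
  later : ∀ {x xs} → ¬ P x → ExactlyOne P xs → ExactlyOne P (x ∷ xs)

ExactlyOne-map : {A B : Set} {P : B → Set} (f : A → B) {xs : List A} →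
  ExactlyOne (λ x → P (f x)) xs → ExactlyOne P (map f xs)
ExactlyOne-map {P = P} f (this p none) =
  this p (λ y∈ Py → let (x , x∈ , y≡) = ∈-map⁻ f y∈ in none x∈ (subst P y≡ Py))
ExactlyOne-map f (later ¬p one) = later ¬p (ExactlyOne-map f one)

ExactlyOne-++ˡ : {A : Set} {P : A → Set} {xs ys : List A} →
  ExactlyOne P xs → (∀ {y} → y ∈ ys → ¬ P y) → ExactlyOne P (xs ++ ys)
ExactlyOne-++ˡ {xs = _ ∷ xs} (this p none) noneʸ = this p (λ y∈ → Sum.[ none , noneʸ ] (∈-++⁻ xs y∈))
ExactlyOne-++ˡ (later ¬p one) noneʸ = later ¬p (ExactlyOne-++ˡ one noneʸ)

ExactlyOne-++ʳ : {A : Set} {P : A → Set} (xs : List A) {ys : List A} →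
  (∀ {x} → x ∈ xs → ¬ P x) → ExactlyOne P ys → ExactlyOne P (xs ++ ys)
ExactlyOne-++ʳ []       noneˣ one = one
ExactlyOne-++ʳ (x ∷ xs) noneˣ one = later (noneˣ (here refl)) (ExactlyOne-++ʳ xs (λ x∈ → noneˣ (there x∈)) one)

ExactlyOne⇒index : {A : Set} {P : A → Set} {xs : List A} → ExactlyOne P xs →
  Σ (Fin (length xs)) λ k → P (lookup xs k) × (∀ k' → P (lookup xs k') → k' ≡ k)
ExactlyOne⇒index (this p none) =
  zero , p , λ { zero _ → refl ; (suc k') Pk' → ⊥-elim (none (∈-lookup k') Pk') }
ExactlyOne⇒index (later ¬p one) =
  let (k , Pk , unique) = ExactlyOne⇒index one
  in suc k , Pk , λ { zero P0 → ⊥-elim (¬p P0) ; (suc k') Pk' → cong suc (unique k' Pk') }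

-- the reassociation of W used when descending from a copy to a child
++-regroup : {A : Set} (as ts ps ms qs bs : List A) →
  as ++ ((ts ++ (ps ++ (ms ++ qs))) ++ bs) ≡ (as ++ (ts ++ ps)) ++ (ms ++ (qs ++ bs))
++-regroup (x ∷ as) ts       ps       ms qs bs = cong (x ∷_) (++-regroup as ts ps ms qs bs)
++-regroup []       (x ∷ ts) ps       ms qs bs = cong (x ∷_) (++-regroup [] ts ps ms qs bs)
++-regroup []       []       (x ∷ ps) ms qs bs = cong (x ∷_) (++-regroup [] [] ps ms qs bs)
++-regroup []       []       []       ms qs bs = ++-assoc ms qs bs

subsets-sound : ∀ k xs {ys} → ys ∈ subsets k xs → length ys ≡ k × ys ⊆ xs
subsets-sound zero    xs       (here refl) = refl , minimum xs
subsets-sound (suc k) (x ∷ xs) ys∈ with ∈-++⁻ (map (x ∷_) (subsets k xs)) ys∈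
... | inj₁ with-x with ∈-map⁻ (x ∷_) with-x
...   | zs , zs∈ , refl = let (len , τ) = subsets-sound k xs zs∈ in cong suc len , refl ∷ τ
subsets-sound (suc k) (x ∷ xs) ys∈ | inj₂ without-x =
  let (len , τ) = subsets-sound (suc k) xs without-x in len , x ∷ʳ τ

subset-avoiding : (B : Label → Set) → (∀ x → Dec (B x)) → ∀ xs n m →
  (∀ V → V ⊆ xs → All B V → length V ≤ m) → n + m ≤ length xs →
  Σ (List Label) λ ys → ys ∈ subsets n xs × All (λ z → ¬ B z) ys
subset-avoiding B B? xs       zero    m _ _ = [] , here refl , []
subset-avoiding B B? (x ∷ xs) (suc n) m sparse n+m≤ with B? x
... | no ¬Bx =
  let (ys , ys∈ , avoid) = subset-avoiding B B? xs n m (λ V τ → sparse V (x ∷ʳ τ)) (≤-pred n+m≤)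
  in x ∷ ys , ∈-++⁺ˡ (∈-map⁺ (x ∷_) ys∈) , ¬Bx ∷ avoid
subset-avoiding B B? (x ∷ xs) (suc n) zero    sparse _ | yes Bx
  with () ← sparse [ x ] (refl ∷ minimum xs) (Bx ∷ [])
subset-avoiding B B? (x ∷ xs) (suc n) (suc m) sparse n+m≤ | yes Bx =
  let (ys , ys∈ , avoid) = subset-avoiding B B? xs (suc n) m
        (λ V τ BV → ≤-pred (sparse (x ∷ V) (refl ∷ τ) (Bx ∷ BV)))
        (≤-pred (subst (_≤ suc (length xs)) (+-suc (suc n) m) n+m≤))
  in ys , ∈-++⁺ʳ (map (x ∷_) (subsets n xs)) ys∈ , avoid

-- the j-th label set S_j (empty when out of range)
nth : List (List Label) → ℕ → List Label
nth []       j       = []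
nth (s ∷ ss) zero    = s
nth (s ∷ ss) (suc j) = nth ss j

InAt⇒nth : ∀ S j {χ} → InAt S j χ → j < length S × χ ∈ nth S j
InAt⇒nth (s ∷ S) zero    χ∈ = s≤s z≤n , χ∈
InAt⇒nth (s ∷ S) (suc j) χ∈ = let (j< , χ∈') = InAt⇒nth S j χ∈ in s≤s j< , χ∈'

nth⇒InAt : ∀ S j {χ} → j < length S → χ ∈ nth S j → InAt S j χ
nth⇒InAt (s ∷ S) zero    _       χ∈ = χ∈
nth⇒InAt (s ∷ S) (suc j) (s≤s j<) χ∈ = nth⇒InAt S j j< χ∈

InAt⇒∈concat : ∀ S j {χ} → InAt S j χ → χ ∈ concat S
InAt⇒∈concat (s ∷ S) zero    χ∈ = ∈-++⁺ˡ χ∈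
InAt⇒∈concat (s ∷ S) (suc j) χ∈ = ∈-++⁺ʳ s (InAt⇒∈concat S j χ∈)

InAt-unique : ∀ S → Unique (concat S) → ∀ j j' {χ} → InAt S j χ → InAt S j' χ → j ≡ j'
InAt-unique (s ∷ S) u zero    zero     _  _  = refl
InAt-unique (s ∷ S) u zero    (suc j') χ∈ χ∈' = ⊥-elim (Unique-++-disjoint s u χ∈ (InAt⇒∈concat S j' χ∈'))
InAt-unique (s ∷ S) u (suc j) zero     χ∈ χ∈' = ⊥-elim (Unique-++-disjoint s u χ∈' (InAt⇒∈concat S j χ∈))
InAt-unique (s ∷ S) u (suc j) (suc j') χ∈ χ∈' =
  cong suc (InAt-unique S (Unique-⊆ (++⁺ˡ s ⊆-refl) u) j j' χ∈ χ∈')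

∈-interleave⁻ : ∀ h a b r {S'} → S' ∈ interleave h (a ∷ b ∷ r) →
  Σ (List Label) λ x → Σ (List Label) λ y → Σ (List (List Label)) λ rest →
  S' ≡ (x ++ y) ∷ rest × x ∈ subsets h a × y ∈ subsets h b × rest ∈ interleave h r
∈-interleave⁻ h a b r S'∈ =
  let (x , x∈ , S'∈₁)       = find (∈-concatMap⁻ (λ x → concatMap (λ y → map ((x ++ y) ∷_) (interleave h r)) (subsets h b)) S'∈)
      (y , y∈ , S'∈₂)       = find (∈-concatMap⁻ (λ y → map ((x ++ y) ∷_) (interleave h r)) S'∈₁)
      (rest , rest∈ , S'≡) = ∈-map⁻ ((x ++ y) ∷_) S'∈₂
  in x , y , rest , S'≡ , x∈ , y∈ , rest∈

∈-interleave⁺ : ∀ h a b r {x y rest} → x ∈ subsets h a → y ∈ subsets h b →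
  rest ∈ interleave h r → ((x ++ y) ∷ rest) ∈ interleave h (a ∷ b ∷ r)
∈-interleave⁺ h a b r {x} {y} x∈ y∈ rest∈ =
  ∈-concatMap⁺ (λ x → concatMap (λ y → map ((x ++ y) ∷_) (interleave h r)) (subsets h b))
    (lose x∈ (∈-concatMap⁺ (λ y → map ((x ++ y) ∷_) (interleave h r))
      (lose y∈ (∈-map⁺ ((x ++ y) ∷_) rest∈))))

interleave-shape : ∀ h S {S'} → S' ∈ interleave h S →
  length S ≡ length S' + length S' × All (λ s → length s ≡ h + h) S' × concat S' ⊆ concat S
interleave-shape h []          (here refl) = refl , [] , []
interleave-shape h (a ∷ b ∷ r) S'∈ with ∈-interleave⁻ h a b r S'∈
... | x , y , rest , refl , x∈ , y∈ , rest∈ =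
  let (len , sizes , τ) = interleave-shape h r rest∈
      (|x| , x⊆) = subsets-sound h a x∈
      (|y| , y⊆) = subsets-sound h b y∈
  in cong suc (trans (cong suc len) (sym (+-suc (length rest) (length rest)))) ,
     trans (length-++ x) (cong₂ _+_ |x| |y|) ∷ sizes ,
     subst (((x ++ y) ++ concat rest) ⊆_) (++-assoc a b (concat r)) (++⁺ (++⁺ x⊆ y⊆) τ)

interleave-origin : ∀ h S {S'} → S' ∈ interleave h S → ∀ j {χ} → InAt S' j χ →
  Σ ℕ λ j' → InAt S j' χ × ⌊ j' /2⌋ ≡ j
interleave-origin h []          (here refl) j ()
interleave-origin h (a ∷ b ∷ r) S'∈ j χ∈ with ∈-interleave⁻ h a b r S'∈
interleave-origin h (a ∷ b ∷ r) S'∈ zero χ∈ | x , y , rest , refl , x∈ , y∈ , rest∈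
  with ∈-++⁻ x χ∈
... | inj₁ χ∈x = 0 , Any-resp-⊆ (proj₂ (subsets-sound h a x∈)) χ∈x , refl
... | inj₂ χ∈y = 1 , Any-resp-⊆ (proj₂ (subsets-sound h b y∈)) χ∈y , refl
interleave-origin h (a ∷ b ∷ r) S'∈ (suc j) χ∈ | x , y , rest , refl , x∈ , y∈ , rest∈ =
  let (j' , χ∈' , half) = interleave-origin h r rest∈ j χ∈ in suc (suc j') , χ∈' , cong suc half

-- Let Busy j χ be a
-- decidable property of the labels of S_j (global index m + j) that holds
-- for at most h labels of each S_j.  Since |S_j| = 2h, each S_j has h
-- non-busy labels, and these can be interleaved.
interleaving-avoiding : ∀ h (Busy : ℕ → Label → Set) → (∀ j χ → Dec (Busy j χ)) →
  (∀ j V → Unique V → All (Busy j) V → length V ≤ h) →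
  ∀ n m ss → length ss ≡ n + n → Unique (concat ss) → All (λ s → length s ≡ h + h) ss →
  Σ (List (List Label)) λ S' → S' ∈ interleave h ss ×
    (∀ j χ → InAt S' j χ → Σ ℕ λ j' → InAt ss j' χ × ¬ Busy (m + j') χ × ⌊ j' /2⌋ ≡ j)
interleaving-avoiding h Busy Busy? sparse zero    m []  _ _ _ = [] , here refl , λ _ _ ()
interleaving-avoiding h Busy Busy? sparse (suc n) m (a ∷ []) len _ _
  with () ← trans (suc-injective len) (+-suc n n)
interleaving-avoiding h Busy Busy? sparse (suc n) m (a ∷ b ∷ r) len u (|a| ∷ |b| ∷ sizes) =
  (x ++ y) ∷ rest , ∈-interleave⁺ h a b r x∈ y∈ rest∈ , origin
  where
    ua : Unique a
    ua = Unique-⊆ (++⁺ʳ (b ++ concat r) ⊆-refl) u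
    ub : Unique b
    ub = Unique-⊆ (++⁺ˡ a (++⁺ʳ (concat r) ⊆-refl)) u
    ur : Unique (concat r)
    ur = Unique-⊆ (++⁺ˡ a (++⁺ˡ b ⊆-refl)) u

    half-of : ∀ s j → Unique s → length s ≡ h + h →
      Σ (List Label) λ z → z ∈ subsets h s × All (λ χ → ¬ Busy j χ) z
    half-of s j us |s| = subset-avoiding (Busy j) (Busy? j) s h h
      (λ V τ BV → sparse j V (Unique-⊆ τ us) BV) (subst (h + h ≤_) (sym |s|) ≤-refl)

    pa = half-of a (m + 0) ua |a|
    x = proj₁ pa
    x∈ = proj₁ (proj₂ pa)
    pb = half-of b (m + 1) ub |b|
    y = proj₁ pb
    y∈ = proj₁ (proj₂ pb)
    pr = interleaving-avoiding h Busy Busy? sparse n (suc (suc m)) r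
           (suc-injective (trans (suc-injective len) (+-suc n n))) ur sizes
    rest = proj₁ pr
    rest∈ = proj₁ (proj₂ pr)

    origin : ∀ j χ → InAt ((x ++ y) ∷ rest) j χ →
      Σ ℕ λ j' → InAt (a ∷ b ∷ r) j' χ × ¬ Busy (m + j') χ × ⌊ j' /2⌋ ≡ j
    origin zero χ χ∈ with ∈-++⁻ x χ∈
    ... | inj₁ χ∈x = 0 , Any-resp-⊆ (proj₂ (subsets-sound h a x∈)) χ∈x , All.lookup (proj₂ (proj₂ pa)) χ∈x , refl
    ... | inj₂ χ∈y = 1 , Any-resp-⊆ (proj₂ (subsets-sound h b y∈)) χ∈y , All.lookup (proj₂ (proj₂ pb)) χ∈y , refl
    origin (suc j) χ χ∈ =
      let (j' , χ∈' , idle , half) = proj₂ (proj₂ pr) j χ χ∈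
      in suc (suc j') , χ∈' ,
         subst (λ i → ¬ Busy i χ) (trans (cong suc (sym (+-suc m j'))) (sym (+-suc m (suc j')))) idle ,
         cong suc half

-- emb p v : the image in G_S of the vertex v of the nested copy reached by
-- the path p of copy indices (innermost index first).
emb : List ℕ → Vertex → Vertex
emb []      v = v
emb (k ∷ p) v = emb p (liftV k v)

-- The image of an edge of a nested copy; defined componentwise, so that
-- `liftP (k ∷ p) e` and `liftP p (liftE k e)` agree definitionally.
liftP : List ℕ → Edge → Edge
liftP p e = edge (emb p (end₁ e)) (emb p (end₂ e)) (labels e)

liftV-injective : ∀ k {v w} → liftV k v ≡ liftV k w → v ≡ w
liftV-injective k {top i}   {top .i}   refl = refl
liftV-injective k {inner a} {inner .a} refl = refl

emb-injective : ∀ p {v w} → emb p v ≡ emb p w → v ≡ w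
emb-injective []      eq = eq
emb-injective (k ∷ p) eq = liftV-injective k (emb-injective p eq)

top-injective : ∀ {i j} → top i ≡ top j → i ≡ j
top-injective refl = refl

emb-inner≢top : ∀ p a j → emb p (inner a) ≢ top j
emb-inner≢top []      a j ()
emb-inner≢top (k ∷ p) a j = emb-inner≢top p (inside k a) j

inside≡liftV⇒same-copy : ∀ i' v i a → inner (inside i a) ≡ liftV i' v → i ≡ i'
inside≡liftV⇒same-copy i' (inner a') i a refl = refl

sender-lift : ∀ p e dir → sender (liftP p e) dir ≡ emb p (sender e dir)
sender-lift p e true  = refl
sender-lift p e false = refl

receiver-lift : ∀ p e dir → receiver (liftP p e) dir ≡ emb p (receiver e dir)
receiver-lift p e true  = refl
receiver-lift p e false = refl

Incident-unlift : ∀ p w e → Incident (emb p w) (liftP p e) → Incident w e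
Incident-unlift p w e (inj₁ w≡) = inj₁ (emb-injective p w≡)
Incident-unlift p w e (inj₂ w≡) = inj₂ (emb-injective p w≡)

sender-incident : ∀ e dir → Incident (sender e dir) e
sender-incident e true  = inj₁ refl
sender-incident e false = inj₂ refl

receiver-incident : ∀ e dir → Incident (receiver e dir) e
receiver-incident e true  = inj₂ refl
receiver-incident e false = inj₁ refl

eTop : List (List Label) → ℕ → Edge
eTop S j = edge (top j) (inner (here ⌊ j /2⌋)) (nth S j)

∈-topEdges⁻ : ∀ m ss {e} → e ∈ topEdges m ss →
  Σ ℕ λ i → i < length ss × e ≡ edge (top (m + i)) (inner (here ⌊ m + i /2⌋)) (nth ss i)
∈-topEdges⁻ m (s ∷ ss) (here refl) =
  0 , s≤s z≤n , subst (λ q → edge (top m) (inner (here ⌊ m /2⌋)) s ≡ edge (top q) (inner (here ⌊ q /2⌋)) s) (sym (+-identityʳ m)) refl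
∈-topEdges⁻ m (s ∷ ss) {e} (there e∈) =
  let (i , i< , e≡) = ∈-topEdges⁻ (suc m) ss e∈
  in suc i , s≤s i< , subst (λ q → e ≡ edge (top q) (inner (here ⌊ q /2⌋)) (nth ss i)) (sym (+-suc m i)) e≡

pos : {X : Set} {x : X} {xs : List X} → x ∈ xs → ℕ
pos x∈ = toℕ (index x∈)

-- Concatenations of blocks f (g 0) x₀ ++ f (g 1) x₁ ++ …; the copies of
-- G_S form such a concatenation, and we need to locate one block in it.
module Blocks {X B : Set} (f : ℕ → X → List B) where

  blocks : (ℕ → ℕ) → List X → List B
  blocks g xs = concat (zipWith f (applyUpTo g (length xs)) xs)

  OtherBlock : (ℕ → ℕ) → ℕ → B → Set
  OtherBlock g j e = Σ ℕ λ i → i ≢ j × Σ X λ x → e ∈ f (g i) x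

  ∈-blocks⁻ : ∀ g xs {e} → e ∈ blocks g xs → Σ X λ x → Σ (x ∈ xs) λ x∈ → e ∈ f (g (pos x∈)) x
  ∈-blocks⁻ g (x ∷ xs) e∈ with ∈-++⁻ (f (g 0) x) e∈
  ... | inj₁ e∈x = x , here refl , e∈x
  ... | inj₂ e∈xs = let (y , y∈ , e∈y) = ∈-blocks⁻ (λ i → g (suc i)) xs e∈xs in y , there y∈ , e∈y

  split-blocks : ∀ g xs {y} (y∈ : y ∈ xs) →
    Σ (List B) λ P → Σ (List B) λ Q →
      blocks g xs ≡ P ++ f (g (pos y∈)) y ++ Q ×
      (∀ {e} → e ∈ P → OtherBlock g (pos y∈) e) × (∀ {e} → e ∈ Q → OtherBlock g (pos y∈) e)
  split-blocks g (x ∷ xs) (here refl) = [] , blocks (λ i → g (suc i)) xs , refl , (λ ()) , in-rest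
    where
      in-rest : ∀ {e} → e ∈ blocks (λ i → g (suc i)) xs → OtherBlock g 0 e
      in-rest e∈ = let (y , y∈ , e∈y) = ∈-blocks⁻ (λ i → g (suc i)) xs e∈ in suc (pos y∈) , (λ ()) , y , e∈y
  split-blocks g (x ∷ xs) (there y∈) with split-blocks (λ i → g (suc i)) xs y∈
  ... | P , Q , eq , otherP , otherQ =
    f (g 0) x ++ P , Q , trans (cong (f (g 0) x ++_) eq) (sym (++-assoc (f (g 0) x) P _)) ,
    (λ e∈ → earlier (∈-++⁻ (f (g 0) x) e∈)) , (λ e∈ → shift (otherQ e∈))
    where
      shift : ∀ {e} → OtherBlock (λ i → g (suc i)) (pos y∈) e → OtherBlock g (suc (pos y∈)) e
      shift (i , i≢ , z , e∈z) = suc i , (λ eq → i≢ (suc-injective eq)) , z , e∈z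
      earlier : ∀ {e} → e ∈ f (g 0) x ⊎ e ∈ P → OtherBlock g (suc (pos y∈)) e
      earlier (inj₁ e∈x) = 0 , (λ ()) , x , e∈x
      earlier (inj₂ e∈P) = shift (otherP e∈P)

copyBlock : ℕ → ℕ → ℕ → List (List Label) → List Edge
copyBlock h d k S' = map (liftE k) (graphEdges h d S')

copyEdges : ℕ → ℕ → List (List Label) → List Edge
copyEdges h d S = Blocks.blocks (copyBlock h d) (λ k → k) (interleave h S)

NotTop : Vertex → Set
NotTop v = ∀ j → v ≢ top j

liftV-notTop : ∀ k v → NotTop (liftV k v)
liftV-notTop k (top i)   j ()
liftV-notTop k (inner a) j ()

∈-copyEdges⇒notTop : ∀ h d S {e} → e ∈ copyEdges h d S → NotTop (end₁ e) × NotTop (end₂ e)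
∈-copyEdges⇒notTop h d S e∈ with Blocks.∈-blocks⁻ (copyBlock h d) (λ k → k) (interleave h S) e∈
... | S' , S'∈ , e∈' with ∈-map⁻ (liftE (pos S'∈)) e∈'
... | e' , _ , refl = liftV-notTop _ (end₁ e') , liftV-notTop _ (end₂ e')

∈-graphEdges⁻ : ∀ h d S {e} → e ∈ graphEdges h d S →
  e ∈ topEdges 0 S ⊎ Σ ℕ λ d' → d ≡ suc d' × e ∈ copyEdges h d' S
∈-graphEdges⁻ h zero    S e∈ = inj₁ e∈
∈-graphEdges⁻ h (suc d) S e∈ with ∈-++⁻ (topEdges 0 S) e∈
... | inj₁ e∈top    = inj₁ e∈top
... | inj₂ e∈copies = inj₂ (d , refl , e∈copies)

edge-cases : ∀ h d S {e} → e ∈ graphEdges h d S →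
  (Σ ℕ λ j → j < length S × e ≡ eTop S j) ⊎ (NotTop (end₁ e) × NotTop (end₂ e))
edge-cases h d S e∈ with ∈-graphEdges⁻ h d S e∈
... | inj₁ e∈top                   = inj₁ (∈-topEdges⁻ 0 S e∈top)
... | inj₂ (d' , refl , e∈copies) = inj₂ (∈-copyEdges⇒notTop h d' S e∈copies)

root-edge-labels : ∀ h d S {e j χ} → e ∈ graphEdges h d S → Incident (top j) e →
  χ ∈ labels e → InAt S j χ
root-edge-labels h d S {j = j} e∈ at-rⱼ χ∈ with edge-cases h d S e∈ | at-rⱼ
... | inj₁ (j' , j'< , refl) | inj₁ refl = nth⇒InAt S j j'< χ∈
... | inj₂ (notTop₁ , _)     | inj₁ r≡   = ⊥-elim (notTop₁ j (sym r≡))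
... | inj₂ (_ , notTop₂)     | inj₂ r≡   = ⊥-elim (notTop₂ j (sym r≡))

-- Nested copies inside the edge list W of the whole graph.  Reasoning about
-- the schedule needs to know which positions of W touch a given copy.
module Copies (h : ℕ) (W : List Edge) where

  AvoidsCopy : List ℕ → List Edge → Set
  AvoidsCopy p A = ∀ {e} → e ∈ A → ∀ a → ¬ Incident (emb p (inner a)) e

  record CopyAt (p : List ℕ) (d : ℕ) (S : List (List Label)) : Set where
    constructor copyAt
    field
      before after : List Edge
      layout       : W ≡ before ++ map (liftP p) (graphEdges h d S) ++ after
      before-avoids : AvoidsCopy p before
      after-avoids  : AvoidsCopy p after

  whole-copy : ∀ d S → W ≡ graphEdges h d S → CopyAt [] d S
  whole-copy d S W≡ = copyAt [] []
    (trans W≡ (sym (trans (++-identityʳ (map (liftP []) (graphEdges h d S))) (map-id (graphEdges h d S)))))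
    (λ ()) (λ ())

  copy-edge : ∀ {p d S} → CopyAt p d S → ∀ a k → Incident (emb p (inner a)) (lookup W k) →
    Σ Edge λ e → e ∈ graphEdges h d S × lookup W k ≡ liftP p e
  copy-edge {p} {d} {S} (copyAt A B layout avoidsA avoidsB) a k touches
    with ∈-++⁻ A (subst (lookup W k ∈_) layout (∈-lookup k))
  ... | inj₁ ∈A = ⊥-elim (avoidsA ∈A a touches)
  ... | inj₂ ∈rest with ∈-++⁻ (map (liftP p) (graphEdges h d S)) ∈rest
  ...   | inj₂ ∈B    = ⊥-elim (avoidsB ∈B a touches)
  ...   | inj₁ ∈copy = ∈-map⁻ (liftP p) ∈copy

  unique-index : ∀ {p d S} → CopyAt p d S → (P : Edge → Set) →
    (∀ {e} → P e → Σ Addr λ a → Incident (emb p (inner a)) e) →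
    ExactlyOne (λ e → P (liftP p e)) (graphEdges h d S) →
    Σ (Fin (length W)) λ k → P (lookup W k) × (∀ k' → P (lookup W k') → k' ≡ k)
  unique-index {p} (copyAt A B layout avoidsA avoidsB) P touches one =
    ExactlyOne⇒index (subst (ExactlyOne P) (sym layout)
      (ExactlyOne-++ʳ A (λ e∈ Pe → let (a , t) = touches Pe in avoidsA e∈ a t)
        (ExactlyOne-++ˡ (ExactlyOne-map (liftP p) one)
                        (λ e∈ Pe → let (a , t) = touches Pe in avoidsB e∈ a t))))

  topEdge-avoids-child : ∀ S i a {e} → e ∈ topEdges 0 S → ¬ Incident (inner (inside i a)) e
  topEdge-avoids-child S i a e∈ touches with ∈-topEdges⁻ 0 S e∈ | touches
  ... | j , _ , refl | inj₁ ()
  ... | j , _ , refl | inj₂ ()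

  other-child-avoids : ∀ d i a {e} → Blocks.OtherBlock (copyBlock h d) (λ k → k) i e →
    ¬ Incident (inner (inside i a)) e
  other-child-avoids d i a (i' , i'≢i , _ , e∈) touches with ∈-map⁻ (liftE i') e∈ | touches
  ... | e' , _ , refl | inj₁ v≡ = i'≢i (sym (inside≡liftV⇒same-copy i' (end₁ e') i a v≡))
  ... | e' , _ , refl | inj₂ v≡ = i'≢i (sym (inside≡liftV⇒same-copy i' (end₂ e') i a v≡))

  child-copy : ∀ {p d S} → CopyAt p (suc d) S → ∀ {S'} (S'∈ : S' ∈ interleave h S) →
    CopyAt (pos S'∈ ∷ p) d S'
  child-copy {p} {d} {S} (copyAt A B layout avoidsA avoidsB) {S'} S'∈
    with Blocks.split-blocks (copyBlock h d) (λ k → k) (interleave h S) S'∈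
  ... | P , Q , split , otherP , otherQ =
    copyAt (A ++ map lp (T ++ P)) (map lp Q ++ B) layout′ avoids-before avoids-after
    where
      i = pos S'∈
      lp = liftP p
      T = topEdges 0 S
      G = graphEdges h d S'
      M = map (liftE i) G
      open ≡-Reasoning

      layout′ : W ≡ (A ++ map lp (T ++ P)) ++ map (liftP (i ∷ p)) G ++ (map lp Q ++ B)
      layout′ = begin
        W                                                     ≡⟨ layout ⟩
        A ++ map lp (T ++ copyEdges h d S) ++ B               ≡⟨ cong (λ cs → A ++ map lp (T ++ cs) ++ B) split ⟩
        A ++ map lp (T ++ P ++ M ++ Q) ++ B                   ≡⟨ cong (λ es → A ++ es ++ B) distribute ⟩
        A ++ (map lp T ++ map lp P ++ map lp M ++ map lp Q) ++ B
          ≡⟨ ++-regroup A (map lp T) (map lp P) (map lp M) (map lp Q) B ⟩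
        (A ++ map lp T ++ map lp P) ++ map lp M ++ map lp Q ++ B
          ≡⟨ cong₂ (λ u v → (A ++ u) ++ v ++ map lp Q ++ B) (sym (map-++ lp T P)) (sym (map-∘ G)) ⟩
        (A ++ map lp (T ++ P)) ++ map (liftP (i ∷ p)) G ++ map lp Q ++ B ∎
        where
          distribute : map lp (T ++ P ++ M ++ Q) ≡ map lp T ++ map lp P ++ map lp M ++ map lp Q
          distribute = trans (map-++ lp T _) (cong (map lp T ++_)
                         (trans (map-++ lp P _) (cong (map lp P ++_) (map-++ lp M Q))))

      lifted-avoids : ∀ {e} → e ∈ T ⊎ Blocks.OtherBlock (copyBlock h d) (λ k → k) i e →
        ∀ a → ¬ Incident (emb (i ∷ p) (inner a)) (lp e)
      lifted-avoids {e} (inj₁ e∈T)   a touches = topEdge-avoids-child S i a e∈T (Incident-unlift p _ e touches)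
      lifted-avoids {e} (inj₂ other) a touches = other-child-avoids d i a other (Incident-unlift p _ e touches)

      avoids-before : AvoidsCopy (i ∷ p) (A ++ map lp (T ++ P))
      avoids-before e∈ a with ∈-++⁻ A e∈
      ... | inj₁ e∈A = avoidsA e∈A (inside i a)
      ... | inj₂ e∈lifted with ∈-map⁻ lp e∈lifted
      ...   | e , e∈' , refl = lifted-avoids (map₂ otherP (∈-++⁻ T e∈')) a

      avoids-after : AvoidsCopy (i ∷ p) (map lp Q ++ B)
      avoids-after e∈ a with ∈-++⁻ (map lp Q) e∈
      ... | inj₂ e∈B = avoidsB e∈B (inside i a)
      ... | inj₁ e∈lifted with ∈-map⁻ lp e∈lifted
      ...   | e , e∈Q , refl = lifted-avoids (inj₂ (otherQ e∈Q)) a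

  TopEdge : List ℕ → ℕ → Edge → Set
  TopEdge p j e = end₁ e ≡ emb p (top j) × end₂ e ≡ emb p (inner (here ⌊ j /2⌋))

  TopEdge-touches : ∀ p j {e} → TopEdge p j e → Σ Addr λ a → Incident (emb p (inner a)) e
  TopEdge-touches p j (_ , end₂≡) = here ⌊ j /2⌋ , inj₂ (sym end₂≡)

  -- e_j occurs exactly once among the top edges (they have distinct roots)
  exactly-one-in-topEdges : ∀ p j m ss → m ≤ j → j < m + length ss →
    ExactlyOne (λ e → TopEdge p j (liftP p e)) (topEdges m ss)
  exactly-one-in-topEdges p j m [] m≤j j< = ⊥-elim (<⇒≱ j< (subst (_≤ j) (sym (+-identityʳ m)) m≤j))
  exactly-one-in-topEdges p j m (s ∷ ss) m≤j j< with m ≟ j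
  ... | yes refl = this (refl , refl) none
    where
      none : ∀ {e} → e ∈ topEdges (suc m) ss → ¬ TopEdge p m (liftP p e)
      none e∈ (end₁≡ , _) with ∈-topEdges⁻ (suc m) ss e∈
      ... | i , _ , refl = m≢1+m+n m (sym (top-injective (emb-injective p end₁≡)))
  ... | no m≢j = later (λ (end₁≡ , _) → m≢j (top-injective (emb-injective p end₁≡)))
                       (exactly-one-in-topEdges p j (suc m) ss (≤∧≢⇒< m≤j m≢j) (subst (j <_) (+-suc m (length ss)) j<))

  exactly-one-topEdge : ∀ p d S j → j < length S → ExactlyOne (λ e → TopEdge p j (liftP p e)) (graphEdges h d S)
  exactly-one-topEdge p zero    S j j< = exactly-one-in-topEdges p j 0 S z≤n j<
  exactly-one-topEdge p (suc d) S j j< = ExactlyOne-++ˡ (exactly-one-in-topEdges p j 0 S z≤n j<) none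
    where
      none : ∀ {e} → e ∈ copyEdges h d S → ¬ TopEdge p j (liftP p e)
      none e∈ (end₁≡ , _) = proj₁ (∈-copyEdges⇒notTop h d S e∈) j (emb-injective p end₁≡)

  topEdge-position : ∀ {p d S} → CopyAt p d S → ∀ j → j < length S →
    Σ (Fin (length W)) λ k → TopEdge p j (lookup W k) × (∀ k' → TopEdge p j (lookup W k') → k' ≡ k)
  topEdge-position {p} {d} {S} cp j j< =
    unique-index cp (TopEdge p j) (λ {e} → TopEdge-touches p j {e}) (exactly-one-topEdge p d S j j<)

-- How packets move through a copy under a valid schedule σ: they enter a
-- copy only at its roots, and reach a hub v_i only over the top edges e_j.
module Propagation (h : ℕ) (S₀ : List (List Label)) (W : List Edge) (σ : Schedule W) (L : ℕ)
                   (valid : ValidSchedule S₀ W σ L) where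
  open Copies h W

  H : ℕ → Vertex → Label → Set
  H = Holds S₀ W σ

  holds-at-start : ∀ {v χ} → H 0 v χ → IsRoot S₀ χ v
  holds-at-start (init root) = root

  holds-step : ∀ {t v χ} → H (suc t) v χ →
    H t v χ ⊎ Σ (Fin (length W)) λ k → Σ Bool λ dir →
      σ t k ≡ just (dir , χ) × H t (sender (lookup W k) dir) χ × receiver (lookup W k) dir ≡ v
  holds-step (keep held)               = inj₁ held
  holds-step (recv k dir σ≡ sent)      = inj₂ (k , dir , σ≡ , sent , refl)

  inner-not-root : ∀ p a χ → ¬ IsRoot S₀ χ (emb p (inner a))
  inner-not-root p a χ (j , _ , v≡) = emb-inner≢top p a j v≡

  reception-in-copy : ∀ {p d S t χ} → CopyAt p d S → t < L → ∀ a k dir →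
    σ t k ≡ just (dir , χ) → receiver (lookup W k) dir ≡ emb p (inner a) →
    H t (sender (lookup W k) dir) χ →
    Σ Edge λ e → e ∈ graphEdges h d S × lookup W k ≡ liftP p e × χ ∈ labels e ×
      H t (emb p (sender e dir)) χ × receiver e dir ≡ inner a
  reception-in-copy {p} {t = t} {χ} cp t<L a k dir σ≡ recv≡ sent
    with copy-edge cp a k (subst (λ v → Incident v (lookup W k)) recv≡ (receiver-incident _ dir))
  ... | e , e∈ , W[k]≡ =
    e , e∈ , W[k]≡ ,
    subst (χ ∈_) (cong labels W[k]≡) (proj₁ (valid t k dir χ t<L σ≡)) ,
    subst (λ v → H t v χ) (trans (cong (λ e′ → sender e′ dir) W[k]≡) (sender-lift p e dir)) sent ,
    emb-injective p (trans (sym (receiver-lift p e dir)) (trans (cong (λ e′ → receiver e′ dir) (sym W[k]≡)) recv≡))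

  mutual
    enters-via-root : ∀ {p d S} → CopyAt p d S → ∀ t → t ≤ L → ∀ a χ → H t (emb p (inner a)) χ →
      Σ ℕ λ j → InAt S j χ × H t (emb p (top j)) χ
    enters-via-root {p} cp zero _ a χ held = ⊥-elim (inner-not-root p a χ (holds-at-start held))
    enters-via-root cp (suc t) t<L a χ held with holds-step held
    ... | inj₁ held′ =
      let (j , χ∈ , root-held) = enters-via-root cp t (≤-trans (n≤1+n t) t<L) a χ held′
      in j , χ∈ , keep root-held
    ... | inj₂ (k , dir , σ≡ , sent , recv≡) =
      let (e , e∈ , _ , χ∈e , sent′ , _) = reception-in-copy cp t<L a k dir σ≡ recv≡ sent
          (j , χ∈ , root-held) = endpoint-source cp (≤-trans (n≤1+n t) t<L) e∈ χ∈e (sender e dir)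
                                   (sender-incident e dir) sent′
      in j , χ∈ , keep root-held

    -- The same for an endpoint of a copy edge carrying χ (an endpoint that
    -- is a root r_j carries only labels of S_j).
    endpoint-source : ∀ {p d S t χ e} → CopyAt p d S → t ≤ L → e ∈ graphEdges h d S → χ ∈ labels e →
      ∀ w → Incident w e → H t (emb p w) χ → Σ ℕ λ j → InAt S j χ × H t (emb p (top j)) χ
    endpoint-source {d = d} {S} cp t≤L e∈ χ∈ (top j) touches held = j , root-edge-labels h d S e∈ touches χ∈ , held
    endpoint-source {t = t} {χ} cp t≤L e∈ χ∈ (inner a) touches held = enters-via-root cp t t≤L a χ held

  -- The roots of a child copy are the hubs v_i of its parent: if the
  -- sender of a child edge carrying χ ∈ S_j holds χ, then the hub
  -- v_{⌊j/2⌋} of the parent already holds χ.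
  child-sender⇒hub-holds : ∀ {p d S t χ j} → CopyAt p (suc d) S → Unique (concat S) → t ≤ L →
    InAt S j χ → ∀ {e dir} → e ∈ copyEdges h d S → χ ∈ labels e → H t (emb p (sender e dir)) χ →
    H t (emb p (inner (here ⌊ j /2⌋))) χ
  child-sender⇒hub-holds {p} {d} {S} {t} {χ} {j} cp uS t≤L χ∈Sⱼ {dir = dir} e∈ χ∈e sent
    with Blocks.∈-blocks⁻ (copyBlock h d) (λ k → k) (interleave h S) e∈
  ... | S' , S'∈ , e∈′ with ∈-map⁻ (liftE (pos S'∈)) e∈′
  ... | e' , e'∈ , refl =
    let sent′ = subst (λ v → H t (emb p v) χ) (sender-lift (pos S'∈ ∷ []) e' dir) sent
        (j″ , χ∈S'ⱼ″ , child-root-held) =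
          endpoint-source (child-copy cp S'∈) t≤L e'∈ χ∈e (sender e' dir) (sender-incident e' dir) sent′
        (j′ , χ∈Sⱼ′ , ⌊j′/2⌋≡) = interleave-origin h S S'∈ j″ χ∈S'ⱼ″
    in subst (λ i → H t (emb p (inner (here ⌊ i /2⌋))) χ) (InAt-unique S uS j′ j χ∈Sⱼ′ χ∈Sⱼ)
         (subst (λ i → H t (emb p (inner (here i))) χ) (sym ⌊j′/2⌋≡) child-root-held)

  reception-at-hub : ∀ {p d S t χ j k dir} → CopyAt p d S → Unique (concat S) → t < L → InAt S j χ →
    σ t k ≡ just (dir , χ) → receiver (lookup W k) dir ≡ emb p (inner (here ⌊ j /2⌋)) →
    H t (sender (lookup W k) dir) χ →
    (TopEdge p j (lookup W k) × dir ≡ true × H t (emb p (top j)) χ) ⊎ H t (emb p (inner (here ⌊ j /2⌋))) χ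
  reception-at-hub {p} {d} {S} {t} {χ} {j} {k} {dir} cp uS t<L χ∈Sⱼ σ≡ recv≡ sent
    with reception-in-copy cp t<L _ k dir σ≡ recv≡ sent
  ... | e , e∈ , W[k]≡ , χ∈e , sent′ , recv′ with ∈-graphEdges⁻ h d S e∈
  ...   | inj₂ (d' , refl , e∈copies) = inj₂ (child-sender⇒hub-holds cp uS (<⇒≤ t<L) χ∈Sⱼ {dir = dir} e∈copies χ∈e sent′)
  ...   | inj₁ e∈top with ∈-topEdges⁻ 0 S e∈top
  ...     | i , i< , refl with InAt-unique S uS i j (nth⇒InAt S i i< χ∈e) χ∈Sⱼ
  ...       | refl = inj₁ ((cong end₁ W[k]≡ , cong end₂ W[k]≡) , outward ,
                           subst (λ b → H t (emb p (sender (eTop S j) b)) χ) outward sent′)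
    where
      toward-hub : ∀ b → receiver (eTop S j) b ≡ inner (here ⌊ j /2⌋) → b ≡ true
      toward-hub true  _ = refl
      toward-hub false ()
      outward = toward-hub dir recv′

  earlier : ∀ {t} {A : ℕ → Set} → Σ ℕ (λ s → s < t × A s) → Σ ℕ (λ s → s < suc t × A s)
  earlier {t} (s , s<t , rest) = s , ≤-trans s<t (n≤1+n t) , rest

  arrival-over-topEdge : ∀ {p d S} → CopyAt p d S → Unique (concat S) → ∀ t → t ≤ L →
    ∀ j χ → InAt S j χ → H t (emb p (inner (here ⌊ j /2⌋))) χ →
    Σ ℕ λ s → s < t × Σ (Fin (length W)) λ k →
      TopEdge p j (lookup W k) × σ s k ≡ just (true , χ) × H s (emb p (top j)) χ
  arrival-over-topEdge {p} cp uS zero _ j χ _ held = ⊥-elim (inner-not-root p _ χ (holds-at-start held))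
  arrival-over-topEdge cp uS (suc t) t<L j χ χ∈Sⱼ held with holds-step held
  ... | inj₁ held′ = earlier (arrival-over-topEdge cp uS t (≤-trans (n≤1+n t) t<L) j χ χ∈Sⱼ held′)
  ... | inj₂ (k , dir , σ≡ , sent , recv≡) with reception-at-hub cp uS t<L χ∈Sⱼ σ≡ recv≡ sent
  ...   | inj₁ (is-top , refl , root-held) = t , ≤-refl , k , is-top , σ≡ , root-held
  ...   | inj₂ held′ = earlier (arrival-over-topEdge cp uS t (≤-trans (n≤1+n t) t<L) j χ χ∈Sⱼ held′)

module LowerBound (h : ℕ) (S₀ : List (List Label)) (W : List Edge) (σ : Schedule W) (L : ℕ)
                  (valid : ValidSchedule S₀ W σ L) (complete : Completes S₀ W σ L) where
  open Copies h W
  open Propagation h S₀ W σ L valid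

  SentDuring : ℕ → ℕ → Fin (length W) → Label → Set
  SentDuring t₀ n k χ = Σ (Fin n) λ u → σ (t₀ + toℕ u) k ≡ just (true , χ)

  SentDuring? : ∀ t₀ n k χ → Dec (SentDuring t₀ n k χ)
  SentDuring? t₀ n k χ = any? λ u → ≡-dec-Maybe (≡-dec-× Bool._≟_ _≟_) (σ (t₀ + toℕ u) k) (just (true , χ))

  sent-during : ∀ {t₀ n k χ s} → t₀ ≤ s → s < t₀ + n → σ s k ≡ just (true , χ) → SentDuring t₀ n k χ
  sent-during {t₀} {n} {k} {χ} {s} t₀≤s s< σ≡ =
    fromℕ< offset< , subst (λ r → σ r k ≡ just (true , χ)) (sym t₀+offset≡s) σ≡
    where
      offset< : s ∸ t₀ < n
      offset< = subst (s ∸ t₀ <_) (m+n∸m≡n t₀ n) (∸-monoˡ-< s< t₀≤s)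
      t₀+offset≡s : t₀ + toℕ (fromℕ< offset<) ≡ s
      t₀+offset≡s = trans (cong (t₀ +_) (toℕ-fromℕ< offset<)) (m+[n∸m]≡n t₀≤s)

  window-capacity : ∀ t₀ n k {V} → Unique V → All (SentDuring t₀ n k) V → length V ≤ n
  window-capacity t₀ n k = slot-bound (λ χ u → σ (t₀ + toℕ u) k ≡ just (true , χ))
    (λ σ≡ σ≡′ → packet≡ (trans (sym σ≡) σ≡′))
    where
      packet≡ : ∀ {χ χ′} → just (true , χ) ≡ just (true , χ′) → χ ≡ χ′
      packet≡ refl = refl

  Late : List ℕ → List (List Label) → ℕ → Set
  Late p S t₀ = ∀ j χ t → InAt S j χ → t < t₀ → t ≤ L → ¬ H t (emb p (top j)) χ

  late⇒after : ∀ {p S t₀ j χ s} → Late p S t₀ → InAt S j χ → s ≤ L → H s (emb p (top j)) χ → t₀ ≤ s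
  late⇒after {t₀ = t₀} {s = s} late χ∈ s≤L held with s <? t₀
  ... | yes s<t₀ = ⊥-elim (late _ _ s χ∈ s<t₀ s≤L held)
  ... | no  s≮t₀ = ≮⇒≥ s≮t₀

  record LateCopy (d t₀ : ℕ) : Set where
    field
      path      : List ℕ
      labelSets : List (List Label)
      copy      : CopyAt path d labelSets
      count     : length labelSets ≡ 2 ^ d
      sizes     : All (λ s → length s ≡ h + h) labelSets
      disjoint  : Unique (concat labelSets)
      late      : Late path labelSets t₀

  -- Leaf level (a copy of depth 1, i.e. a single edge (r_0 , v_0) carrying
  -- 2h labels): v_0 is a leaf of every tree, so all 2h packets cross this
  -- edge after round t₀ and before round L, one per round.
  leaf-level : ∀ {t₀} → LateCopy 0 t₀ → h + h ≤ L ∸ t₀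
  leaf-level {t₀} record { path = p ; labelSets = s ∷ [] ; copy = cp ; sizes = |s| ∷ [] ;
                          disjoint = u ; late = late } =
    subst (_≤ L ∸ t₀) |s| (window-capacity t₀ (L ∸ t₀) k₀ (subst Unique (++-identityʳ s) u) (All.tabulate arrival))
    where
      leaf = emb p (inner (here 0))

      leaf-edge = topEdge-position cp 0 (s≤s z≤n)
      k₀ = proj₁ leaf-edge

      is-leaf : ∀ {χ} → χ ∈ s → IsLeaf S₀ W χ leaf
      is-leaf {χ} χ∈ with unique-index cp (λ e → χ ∈ labels e × Incident leaf e) (λ (_ , at) → here 0 , at)
                             (this (χ∈ , inj₂ refl) (λ ()))
      ... | k , at-k , unique = inner-not-root p (here 0) χ , k , at-k , λ k′ χ∈′ at′ → unique k′ (χ∈′ , at′)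

      arrival : ∀ {χ} → χ ∈ s → SentDuring t₀ (L ∸ t₀) k₀ χ
      arrival {χ} χ∈ with arrival-over-topEdge cp u L ≤-refl 0 χ χ∈ (complete χ leaf (is-leaf χ∈))
      ... | s′ , s′<L , k , is-top , σ≡ , root-held with proj₂ (proj₂ leaf-edge) k is-top
      ... | refl = sent-during (late⇒after {p} {s ∷ []} late χ∈ (<⇒≤ s′<L) root-held) (≤-trans s′<L (m≤n+m∸n L t₀)) σ≡
  leaf-level record { labelSets = [] ; count = () }
  leaf-level record { labelSets = _ ∷ _ ∷ _ ; count = () }

  topEdgeIndex : ∀ {p d S} → CopyAt p d S → ℕ → Maybe (Fin (length W))
  topEdgeIndex {S = S} cp j with j <? length S
  ... | yes j< = just (proj₁ (topEdge-position cp j j<))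
  ... | no  _  = nothing

  topEdgeIndex-spec : ∀ {p d S} (cp : CopyAt p d S) j → j < length S →
    ∀ k → TopEdge p j (lookup W k) → topEdgeIndex cp j ≡ just k
  topEdgeIndex-spec {S = S} cp j j< k is-top with j <? length S
  ... | yes j<′ = cong just (sym (proj₂ (proj₂ (topEdge-position cp j j<′)) k is-top))
  ... | no  j≮  = ⊥-elim (j≮ j<)

  BusyOn : ℕ → Maybe (Fin (length W)) → Label → Set
  BusyOn t₀ (just k) χ = SentDuring t₀ h k χ
  BusyOn t₀ nothing  χ = ⊥

  BusyOn? : ∀ t₀ m χ → Dec (BusyOn t₀ m χ)
  BusyOn? t₀ (just k) χ = SentDuring? t₀ h k χ
  BusyOn? t₀ nothing  χ = no λ ()

  few-busy : ∀ t₀ m {V} → Unique V → All (BusyOn t₀ m) V → length V ≤ h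
  few-busy t₀ (just k) uV busy = window-capacity t₀ h k uV busy
  few-busy t₀ nothing  uV []   = z≤n

  -- During the h rounds [t₀ , t₀ + h) each top edge
  -- e_j carries at most h packets; call those labels busy.  Interleave h
  -- non-busy labels of each S_j: in the resulting child copy no root
  -- v_{⌊j/2⌋} can hold one of its labels before round t₀ + h, since such a
  -- label first crosses e_j (from the late root r_j) at a round ≥ t₀ + h.
  descend : ∀ {d t₀} → LateCopy (suc d) t₀ → LateCopy d (t₀ + h)
  descend {d} {t₀} record { path = p ; labelSets = S ; copy = cp ; count = count ; sizes = sizes ;
                            disjoint = u ; late = late } =
    record { path = pos S'∈ ∷ p ; labelSets = S' ; copy = child-copy cp S'∈
           ; count = double-injective _ _ (trans (sym (proj₁ shape)) count′)
           ; sizes = proj₁ (proj₂ shape) ; disjoint = Unique-⊆ (proj₂ (proj₂ shape)) u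
           ; late = child-late }
    where
      count′ : length S ≡ 2 ^ d + 2 ^ d
      count′ = trans count (cong (2 ^ d +_) (+-identityʳ (2 ^ d)))

      chosen = interleaving-avoiding h (λ j → BusyOn t₀ (topEdgeIndex cp j)) (λ j → BusyOn? t₀ (topEdgeIndex cp j))
                 (λ j V → few-busy t₀ (topEdgeIndex cp j) {V}) (2 ^ d) 0 S count′ u sizes
      S' = proj₁ chosen
      S'∈ = proj₁ (proj₂ chosen)
      shape = interleave-shape h S S'∈

      child-late : Late (pos S'∈ ∷ p) S' (t₀ + h)
      child-late j″ χ t χ∈S' t< t≤L held with proj₂ (proj₂ chosen) j″ χ χ∈S'
      ... | j , χ∈S , idle , ⌊j/2⌋≡
        with arrival-over-topEdge cp u t t≤L j χ χ∈S (subst (λ i → H t (emb p (inner (here i))) χ) (sym ⌊j/2⌋≡) held)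
      ... | s , s<t , k , is-top , σ≡ , root-held =
        idle (subst (λ m → BusyOn t₀ m χ) (sym (topEdgeIndex-spec cp j (proj₁ (InAt⇒nth S j χ∈S)) k is-top))
               (sent-during (late⇒after {p} {S} late χ∈S (≤-trans (<⇒≤ s<t) t≤L) root-held) (<-trans s<t t<) σ≡))

  copy-bound : 1 ≤ h → ∀ d {t₀} → LateCopy d t₀ → t₀ + h * suc d ≤ L
  copy-bound 1≤h zero    {t₀} c = subst (λ n → t₀ + n ≤ L) (sym (*-identityʳ h))
                                    (window-end 1≤h (≤-trans (m≤m+n h h) (leaf-level c)))
  copy-bound 1≤h (suc d) {t₀} c = subst (_≤ L) (trans (+-assoc t₀ h (h * suc d)) (cong (t₀ +_) (sym (*-suc h (suc d)))))
                                    (copy-bound 1≤h d (descend c))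

lemma4 : (C D : ℕ) → 2 ≤ C → 2 ∣ C → 1 ≤ D →
    (S : List (List Label)) → length S ≡ 2 ^ (D ∸ 1) →
    All (λ s → length s ≡ C) S → Unique (concat S) →
    (σ : Schedule (graphEdges ⌊ C /2⌋ (D ∸ 1) S)) (L : ℕ) →
    ValidSchedule S (graphEdges ⌊ C /2⌋ (D ∸ 1) S) σ L →
    Completes S (graphEdges ⌊ C /2⌋ (D ∸ 1) S) σ L →
    C * D ≤ 2 * L
lemma4 C (suc d) 2≤C 2∣C _ S count sizes disjoint σ L valid complete = begin
  C * suc d              ≡⟨ cong (_* suc d) C≡h+h ⟩
  (h + h) * suc d        ≡⟨ *-distribʳ-+ (suc d) h h ⟩
  h * suc d + h * suc d  ≤⟨ +-mono-≤ per-half per-half ⟩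
  L + L                  ≡⟨ cong (L +_) (sym (+-identityʳ L)) ⟩
  2 * L                  ∎
  where
    open ≤-Reasoning
    h = ⌊ C /2⌋
    C≡h+h = even⇒double-half C 2∣C
    open Copies h (graphEdges h d S)
    open LowerBound h S (graphEdges h d S) σ L valid complete

    whole : LateCopy d 0
    whole = record { path = [] ; labelSets = S ; copy = whole-copy d S refl ; count = count
                   ; sizes = All.map (λ |s| → trans |s| C≡h+h) sizes ; disjoint = disjoint
                   ; late = λ { _ _ _ _ () } }

    per-half : h * suc d ≤ L
    per-half = copy-bound (positive-half h (subst (2 ≤_) C≡h+h 2≤C)) d whole
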